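{- Let $I_1, J_1, I_2, J_2, \ldots$ be nonempty finite intervals in $\mathbb{Z}$ such that: (i) for every positive integer $k$, $\min J_k=\max I_k+1$ and $\min I_{k+1}=\max J_k+1$; (ii) the cardinalities $\# I_k$ form a strictly increasing sequence; (iii) the cardinalities $\# J_k$ form a strictly increasing sequence. Then each of the following sets admits a minimal complement and admits no minimal asymptotic complement in $\mathbb{Z}$: (1) $\bigcup_{k=1}^\infty I_k$; (2) $\mathbb{Z}_{<\min I_1}\cup \bigcup_{k=1}^\infty I_k$; (3) $(\mathbb{Z}_{<\min I_1}\setminus F)\cup \bigcup_{k=1}^\infty I_k$, for any nonempty finite subset $F$ of $\mathbb{Z}$; (4) $\{x\in \mathbb{Z}_{<\min I_1} : x\equiv a \bmod n\}\cup \bigcup_{k=1}^\infty I_k$, for any integers $a,n$ with $n\neq 0$.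
   Context: A nonempty subset $X\subseteq\mathbb{Z}$ is an interval if whenever $x_1\le x_2$ are in $X$, every integer $n$ with $x_1\le n\le x_2$ is in $X$. $\mathbb{Z}_{<x}=\{n\in\mathbb{Z}: n<x\}$. For nonempty $A,B\subseteq\mathbb{Z}$, $A+B=\{a+b: a\in A,b\in B\}$. Given nonempty $W,C\subseteq \mathbb{Z}$: $C$ is a complement to $W$ if $W+C=\mathbb{Z}$; a minimal complement if it is a complement but $C\setminus\{c\}$ is not for every $c\in C$. $C$ is an asymptotic complement to $W$ if $\mathbb{Z}\setminus(W+C)$ is finite; a minimal asymptotic complement if it is an asymptotic complement but $C\setminus\{c\}$ is not for every $c\in C$. -}

module Defs where

open import Data.Integer using (ℤ; _+_; _-_; _≤_; _<_; +_; -_)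
open import Data.Integer.Divisibility using (_∣_)
open import Data.Nat using (ℕ; suc)
open import Data.List using (List; [])
open import Data.List.Membership.Propositional using (_∈_; _∉_)
open import Data.Product using (Σ; ∃; _×_; _,_)
open import Data.Sum using (_⊎_)
open import Relation.Nullary using (¬_)
open import Relation.Binary.PropositionalEquality using (_≡_; _≢_)

Subset : Set₁
Subset = ℤ → Set

Nonempty : Subset → Set
Nonempty C = ∃ λ c → C c

_⊕_ : Subset → Subset → Subset
(A ⊕ B) x = ∃ λ a → ∃ λ b → A a × B b × x ≡ a + b

remove : Subset → ℤ → Subset
remove C c x = C x × x ≢ c

FiniteSet : Subset → Set
FiniteSet S = ∃ λ (L : List ℤ) → ∀ x → S x → x ∈ L

IsComplement : Subset → Subset → Set
IsComplement W C = Nonempty C × (∀ x → (W ⊕ C) x)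

IsMinimalComplement : Subset → Subset → Set
IsMinimalComplement W C =
  IsComplement W C × (∀ c → C c → ¬ IsComplement W (remove C c))

IsAsymptoticComplement : Subset → Subset → Set
IsAsymptoticComplement W C = Nonempty C × FiniteSet (λ x → ¬ (W ⊕ C) x)

IsMinimalAsymptoticComplement : Subset → Subset → Set
IsMinimalAsymptoticComplement W C =
  IsAsymptoticComplement W C × (∀ c → C c → ¬ IsAsymptoticComplement W (remove C c))

GoodSet : Subset → Set₁
GoodSet W = (∃ λ (C : Subset) → IsMinimalComplement W C)
          × ¬ (∃ λ (C : Subset) → IsMinimalAsymptoticComplement W C)

Interval : ℤ → ℤ → Subset
Interval lo hi x = lo ≤ x × x ≤ hi

card : ℤ → ℤ → ℤ
card lo hi = hi - lo + + 1

-- Hypotheses on the endpoint sequences: I_{k+1} = [a k, b k], J_{k+1} = [c k, d k]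
-- (sequences indexed from 0, i.e. index k corresponds to the paper's k+1).
record IntervalData (a b c d : ℕ → ℤ) : Set where
  field
    I-nonempty : ∀ k → a k ≤ b k
    J-nonempty : ∀ k → c k ≤ d k
    J-after-I  : ∀ k → c k ≡ b k + + 1
    I-after-J  : ∀ k → a (suc k) ≡ d k + + 1
    I-card-inc : ∀ k → card (a k) (b k) < card (a (suc k)) (b (suc k))
    J-card-inc : ∀ k → card (c k) (d k) < card (c (suc k)) (d (suc k))

W₁ : (ℕ → ℤ) → (ℕ → ℤ) → Subset
W₁ a b x = ∃ λ k → Interval (a k) (b k) x

W₂ : (ℕ → ℤ) → (ℕ → ℤ) → Subset
W₂ a b x = x < a 0 ⊎ W₁ a b x

W₃ : (ℕ → ℤ) → (ℕ → ℤ) → List ℤ → Subset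
W₃ a b F x = (x < a 0 × x ∉ F) ⊎ W₁ a b x

W₄ : (ℕ → ℤ) → (ℕ → ℤ) → ℤ → ℤ → Subset
W₄ a b r n x = (x < a 0 × n ∣ (x - r)) ⊎ W₁ a b x

module Submission where

open import Defs
open import Data.Integer using (ℤ; +_)
open import Data.Nat using (ℕ)
open import Data.List using (List; [])
open import Data.Product using (_×_)
open import Relation.Binary.PropositionalEquality using (_≢_)

open import Data.Integer using (-[1+_]; _+_; _-_; -_; _*_; _≤_; _<_; ∣_∣; +≤+; -≤+; _≤?_; _<?_; _≟_; NonZero; ≢-nonZero; _%_; _/_)
open import Data.Integer.Properties using (≤-refl; ≤-reflexive; ≤-trans; <⇒≤; <⇒≢; <⇒≱; ≮⇒≥; ≰⇒>; <-irrefl; <-cmp; i≤j⇒0≤j-i; 0≤i-j⇒j≤i; i<j⇒suc[i]≤j; suc[i]≤j⇒i<j; +-comm; +-identityʳ; +-mono-≤; +-monoˡ-≤; neg-mono-≤; neg-≤-pos; 0≤i⇒+∣i∣≡i; drop‿+≤+; module ≤-Reasoning)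
open import Data.Integer.DivMod using (n%d<d; a≡a%n+[a/n]*n)
import Data.Integer.Divisibility as Unsigned
open import Data.Integer.Divisibility.Signed using (_∣_; divides; ∣m⇒∣-m; ∣m∣n⇒∣m+n; ∣ᵤ⇒∣; ∣⇒∣ᵤ)
open import Data.Integer.Tactic.RingSolver using (solve-∀; solve)
open import Data.Nat as ℕ using (zero; suc; z≤n; s≤s)
import Data.Nat.Properties as ℕ
import Data.Nat.Divisibility as ℕ
open import Data.Fin using (Fin; toℕ; fromℕ<)
import Data.Fin.Properties as Fin
import Data.Vec.Functional as Vector
open import Data.List using (_∷_; _++_; map; foldr; applyUpTo; tabulate)
open import Data.List.Membership.Propositional using (_∈_; _∉_; find; lose)
open import Data.List.Membership.Propositional.Properties using (∈-applyUpTo⁺; ∈-tabulate⁺; ∈-map⁺; ∈-++⁺ˡ; ∈-++⁺ʳ)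
open import Data.List.Membership.DecPropositional _≟_ using (_∈?_)
open import Data.List.Relation.Unary.Any using (Any; here; there; any?)
open import Data.Product using (Σ; ∃; ∃₂; _,_; proj₁; proj₂)
open import Data.Sum using (_⊎_; inj₁; inj₂; [_,_])
open import Data.Empty using (⊥; ⊥-elim)
open import Function using (_∘_)
open import Function.Definitions using (Injective)
open import Relation.Nullary using (¬_; Dec; yes; no)
open import Relation.Nullary.Decidable using (decidable-stable; map′; _×-dec_; _⊎-dec_; ¬?)
open import Relation.Binary.PropositionalEquality using (_≡_; refl; sym; trans; cong; cong₂; subst; subst₂; ≢-sym; module ≡-Reasoning)
open import Relation.Binary.Definitions using (tri<; tri≈; tri>)

-- Each of the four sets W is *layered*: it is the union of all intervals I_k together with
-- some points below min I_1, so it misses every gap J_k; both intervals and gaps grow.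
--   * Minimal complement (module Greedy, instantiated in OnLayered): visit 0, 1, -1, 2, …
--     and give each still uncovered z a new element c with z - c an endpoint of a far
--     interval.  The gap next to that interval is so long that c moves every earlier
--     witness into it, so each element keeps a witness covered by it alone: minimality.
--   * No minimal asymptotic complement (OnLayered): an asymptotic complement C is infinite,
--     since a bounded C leaves points in the long gaps uncovered.  If lo < mid < hi lie in C,
--     removing mid uncovers only finitely many points w + mid: for w ∈ I_k the element hi or
--     lo covers it unless I_k is shorter than hi - lo, and for w below min I_1 another c′ ∈ C
--     covers it unless w "escapes" W under the shift mid - c′.  Escapes are finite for all
--     shifts (W₁, W₂, W₃) or for shifts by multiples of n (W₄); by pigeonhole C contains
--     p < q with n ∣ q - p and some third element, so p or q is removable.

-- x ≤ y is certified by a non-negative t with y ≡ t + x.  In use, t is a sum of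
-- differences already known to be non-negative and the identity is a ring identity.
≤-by : ∀ {x y} t → + 0 ≤ t → y ≡ t + x → x ≤ y
≤-by {x} {y} t 0≤t y≡t+x = 0≤i-j⇒j≤i (subst (+ 0 ≤_) t≡y-x 0≤t)
  where
  t≡y-x : t ≡ y - x
  t≡y-x = sym (trans (cong (_- x) y≡t+x) (solve (t ∷ x ∷ [])))

split-off : ∀ x c → x ≡ (x - c) + c
split-off = solve-∀

difference : ∀ {x w m} → x ≡ w + m → w ≡ x - m
difference {w = w} {m} refl = cancel w m
  where
  cancel : ∀ w m → w ≡ w + m - m
  cancel = solve-∀

δ≤ : ∀ {x y} → x ≤ y → + 0 ≤ y - x
δ≤ = i≤j⇒0≤j-i

δ< : ∀ {x y} → x < y → + 0 ≤ y - (+ 1 + x)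
δ< x<y = i≤j⇒0≤j-i (i<j⇒suc[i]≤j x<y)

δℕ : ∀ k → + 0 ≤ + k
δℕ k = +≤+ z≤n

infixl 6 _⊞_
_⊞_ : ∀ {s t} → + 0 ≤ s → + 0 ≤ t → + 0 ≤ s + t
_⊞_ = +-mono-≤

i≤+∣i∣ : ∀ i → i ≤ + ∣ i ∣
i≤+∣i∣ (+ n)    = ≤-refl
i≤+∣i∣ -[1+ n ] = -≤+

-+∣i∣≤i : ∀ i → - + ∣ i ∣ ≤ i
-+∣i∣≤i (+ n)    = neg-≤-pos
-+∣i∣≤i -[1+ n ] = ≤-refl

≤-abs : ∀ {k i} → + k ≤ i → k ℕ.≤ ∣ i ∣
≤-abs {k} {i} k≤i = drop‿+≤+ (≤-trans k≤i (i≤+∣i∣ i))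

window : ℤ → ℤ → List ℤ
window lo hi = applyUpTo (λ i → lo + + i) (suc ∣ hi - lo ∣)

∈-window : ∀ {lo hi x} → lo ≤ x → x ≤ hi → x ∈ window lo hi
∈-window {lo} {hi} {x} lo≤x x≤hi =
  subst (_∈ window lo hi) lo+m≡x (∈-applyUpTo⁺ (λ i → lo + + i) (s≤s m≤n))
  where
  m≡x-lo : + ∣ x - lo ∣ ≡ x - lo
  m≡x-lo = 0≤i⇒+∣i∣≡i (δ≤ lo≤x)
  n≡hi-lo : + ∣ hi - lo ∣ ≡ hi - lo
  n≡hi-lo = 0≤i⇒+∣i∣≡i (δ≤ (≤-trans lo≤x x≤hi))
  m≤n : ∣ x - lo ∣ ℕ.≤ ∣ hi - lo ∣
  m≤n = drop‿+≤+ (subst₂ _≤_ (sym m≡x-lo) (sym n≡hi-lo) (+-monoˡ-≤ (- lo) x≤hi))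
  lo+m≡x : lo + + ∣ x - lo ∣ ≡ x
  lo+m≡x = trans (cong (λ m → lo + m) m≡x-lo) (solve (lo ∷ x ∷ []))

∉-window : ∀ {lo hi x} → x ∉ window lo hi → x < lo ⊎ hi < x
∉-window {lo} {hi} {x} x∉ with lo ≤? x | x ≤? hi
... | no  lo≰x | _        = inj₁ (≰⇒> lo≰x)
... | yes _    | no  x≰hi = inj₂ (≰⇒> x≰hi)
... | yes lo≤x | yes x≤hi = ⊥-elim (x∉ (∈-window lo≤x x≤hi))

∈-crossing-window : ∀ {floor y t} → y < floor → floor ≤ y + t → y ∈ window (floor - t) floor
∈-crossing-window {floor} {y} {t} y<floor floor≤y+t = ∈-window lower upper
  where
  lower : floor - t ≤ y
  lower = ≤-by (y + t - floor) (δ≤ floor≤y+t) (solve (floor ∷ y ∷ t ∷ []))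
  upper : y ≤ floor
  upper = ≤-by (floor - (+ 1 + y) + + 1) (δ< y<floor ⊞ δℕ 1) (solve (floor ∷ y ∷ []))

bound : List ℤ → ℕ
bound = foldr (λ x m → ∣ x ∣ ℕ.⊔ m) 0

∣∣≤bound : ∀ {x xs} → x ∈ xs → ∣ x ∣ ℕ.≤ bound xs
∣∣≤bound {xs = y ∷ ys} (here refl) = ℕ.m≤m⊔n ∣ y ∣ (bound ys)
∣∣≤bound {xs = y ∷ ys} (there x∈) = ℕ.≤-trans (∣∣≤bound x∈) (ℕ.m≤n⊔m ∣ y ∣ (bound ys))

≤bound : ∀ {x xs} → x ∈ xs → x ≤ + bound xs
≤bound {x} x∈ = ≤-trans (i≤+∣i∣ x) (+≤+ (∣∣≤bound x∈))

-bound≤ : ∀ {x xs} → x ∈ xs → - + bound xs ≤ x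
-bound≤ {x} x∈ = ≤-trans (neg-mono-≤ (+≤+ (∣∣≤bound x∈))) (-+∣i∣≤i x)

outside : ∀ {C : Subset} → ¬ FiniteSet C → ∀ L → ¬ ¬ (∃ λ x → C x × x ∉ L)
outside infinite L none =
  infinite (L , λ x Cx → decidable-stable (x ∈? L) (λ x∉L → none (x , Cx , x∉L)))

distinct-elements : ∀ {C : Subset} → ¬ FiniteSet C → ∀ k →
  ¬ ¬ (Σ (Fin k → ℤ) λ f → (∀ i → C (f i)) × Injective _≡_ _≡_ f)
distinct-elements infinite zero none = none ((λ ()) , (λ ()) , λ { {()} })
distinct-elements {C} infinite (suc k) none =
  distinct-elements infinite k λ (f , Cf , f-inj) →
  outside infinite (tabulate f) λ (x , Cx , x∉) →
  none (x Vector.∷ f , extend-C Cx Cf , extend-injective f-inj x∉)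
  where
  extend-C : ∀ {x} {f : Fin k → ℤ} → C x → (∀ i → C (f i)) → ∀ i → C ((x Vector.∷ f) i)
  extend-C Cx Cf Fin.zero = Cx
  extend-C Cx Cf (Fin.suc i) = Cf i
  extend-injective : ∀ {x} {f : Fin k → ℤ} → Injective _≡_ _≡_ f → x ∉ tabulate f →
                     Injective _≡_ _≡_ (x Vector.∷ f)
  extend-injective {f = f} inj x∉ {Fin.zero}  {Fin.zero}  _ = refl
  extend-injective {f = f} inj x∉ {Fin.zero}  {Fin.suc j} x≡fj = ⊥-elim (x∉ (subst (_∈ tabulate f) (sym x≡fj) (∈-tabulate⁺ j)))
  extend-injective {f = f} inj x∉ {Fin.suc i} {Fin.zero}  fi≡x = ⊥-elim (x∉ (subst (_∈ tabulate f) fi≡x (∈-tabulate⁺ i)))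
  extend-injective {f = f} inj x∉ {Fin.suc i} {Fin.suc j} fi≡fj = cong Fin.suc (inj fi≡fj)

equal-residues : ∀ n .{{_ : NonZero n}} x y → x % n ≡ y % n → n ∣ (x - y)
equal-residues n x y x%n≡y%n = divides (x / n - y / n) (begin
  x - y                                                   ≡⟨ cong₂ _-_ (a≡a%n+[a/n]*n x n) (a≡a%n+[a/n]*n y n) ⟩
  (+ (x % n) + x / n * n) - (+ (y % n) + y / n * n)       ≡⟨ cong (λ r → (+ r + x / n * n) - (+ (y % n) + y / n * n)) x%n≡y%n ⟩
  (+ (y % n) + x / n * n) - (+ (y % n) + y / n * n)       ≡⟨ cancel (+ (y % n)) (x / n) (y / n) n ⟩
  (x / n - y / n) * n                                     ∎)
  where
  open ≡-Reasoning
  cancel : ∀ r q q′ n → (r + q * n) - (r + q′ * n) ≡ (q - q′) * n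
  cancel = solve-∀

flip-∣ : ∀ {n x y} → n ∣ (x - y) → n ∣ (y - x)
flip-∣ {n} {x} {y} n∣x-y = subst (n ∣_) (negate-difference x y) (∣m⇒∣-m n∣x-y)
  where
  negate-difference : ∀ x y → - (x - y) ≡ y - x
  negate-difference = solve-∀

congruent-pair : ∀ {C : Subset} n → n ≢ + 0 → ¬ FiniteSet C →
  ¬ ¬ (∃₂ λ p q → C p × C q × p < q × n ∣ (q - p))
congruent-pair {C} n n≢0 infinite found =
  distinct-elements infinite (suc ∣ n ∣) λ (f , Cf , f-inj) →
  let (i , j , i<j , same) = Fin.pigeonhole (ℕ.n<1+n ∣ n ∣) (residue ∘ f)
      n∣fj-fi = equal-residues n (f j) (f i) (sym (residue-injective (f i) (f j) same))
  in orient f Cf (Fin.<⇒≢ i<j ∘ f-inj) n∣fj-fi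
  where
  instance
    n-nonZero : NonZero n
    n-nonZero = ≢-nonZero n≢0
  residue : ℤ → Fin ∣ n ∣
  residue x = fromℕ< (n%d<d x n)
  residue-injective : ∀ x y → residue x ≡ residue y → x % n ≡ y % n
  residue-injective x y eq =
    trans (sym (Fin.toℕ-fromℕ< (n%d<d x n))) (trans (cong toℕ eq) (Fin.toℕ-fromℕ< (n%d<d y n)))
  orient : ∀ {k} (f : Fin k → ℤ) {i j} → (∀ i → C (f i)) → f i ≢ f j → n ∣ (f j - f i) → ⊥
  orient f {i} {j} Cf fi≢fj n∣ with <-cmp (f i) (f j)
  ... | tri< fi<fj _ _ = found (f i , f j , Cf i , Cf j , fi<fj , n∣)
  ... | tri≈ _ fi≡fj _ = fi≢fj fi≡fj
  ... | tri> _ _ fj<fi = found (f j , f i , Cf j , Cf i , fj<fi , flip-∣ {n} {f j} {f i} n∣)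

module Increasing (f : ℕ → ℤ) (f-step : ∀ k → f k < f (suc k)) where

  growth : ∀ k → f 0 + + k ≤ f k
  growth zero    = ≤-reflexive (+-identityʳ (f 0))
  growth (suc k) = ≤-by (f (suc k) - (+ 1 + f k) + (f k - (f 0 + + k)))
                        (δ< (f-step k) ⊞ δ≤ (growth k))
                        (regroup (f 0) (f k) (f (suc k)) (+ k))
    where
    regroup : ∀ f₀ fₖ fₖ₊₁ K → fₖ₊₁ ≡ fₖ₊₁ - (+ 1 + fₖ) + (fₖ - (f₀ + K)) + (f₀ + (+ 1 + K))
    regroup = solve-∀

  mono : ∀ {j k} → j ℕ.≤ k → f j ≤ f k
  mono j≤k = mono′ (ℕ.≤⇒≤′ j≤k)
    where
    mono′ : ∀ {j k} → j ℕ.≤′ k → f j ≤ f k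
    mono′ ℕ.≤′-refl          = ≤-refl
    mono′ (ℕ.≤′-step j≤′k) = ≤-trans (mono′ j≤′k) (<⇒≤ (f-step _))

long-intervals : (lo hi : ℕ → ℤ) → (∀ k → lo k ≤ hi k) →
  (∀ k → card (lo k) (hi k) < card (lo (suc k)) (hi (suc k))) → ∀ k → lo k + + k ≤ hi k
long-intervals lo hi nonempty increasing k =
  ≤-by (card (lo k) (hi k) - (+ 1 + + k)) (δ≤ at-least-k+1) (regroup (lo k) (hi k) (+ k))
  where
  open Increasing (λ k → card (lo k) (hi k)) increasing
  card≥1 : + 1 ≤ card (lo 0) (hi 0)
  card≥1 = ≤-by (hi 0 - lo 0) (δ≤ (nonempty 0)) refl
  at-least-k+1 : + 1 + + k ≤ card (lo k) (hi k)
  at-least-k+1 = ≤-trans (+-monoˡ-≤ (+ k) card≥1) (growth k)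
  regroup : ∀ lo hi K → hi ≡ hi - lo + + 1 - (+ 1 + K) + (lo + K)
  regroup = solve-∀

module Intervals {a b c d : ℕ → ℤ} (ID : IntervalData a b c d) where
  open IntervalData ID
  open ≤-Reasoning

  b<c : ∀ k → b k < c k
  b<c k = suc[i]≤j⇒i<j (≤-reflexive (trans (+-comm (+ 1) (b k)) (sym (J-after-I k))))

  d<a : ∀ k → d k < a (suc k)
  d<a k = suc[i]≤j⇒i<j (≤-reflexive (trans (+-comm (+ 1) (d k)) (sym (I-after-J k))))

  I-long : ∀ k → a k + + k ≤ b k
  I-long = long-intervals a b I-nonempty I-card-inc

  J-long : ∀ k → c k + + k ≤ d k
  J-long = long-intervals c d J-nonempty J-card-inc

  a-step : ∀ k → a k < a (suc k)
  a-step k = begin-strict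
    a k       ≤⟨ I-nonempty k ⟩
    b k       <⟨ b<c k ⟩
    c k       ≤⟨ J-nonempty k ⟩
    d k       <⟨ d<a k ⟩
    a (suc k) ∎

  b-step : ∀ k → b k < b (suc k)
  b-step k = begin-strict
    b k       <⟨ b<c k ⟩
    c k       ≤⟨ J-nonempty k ⟩
    d k       <⟨ d<a k ⟩
    a (suc k) ≤⟨ I-nonempty (suc k) ⟩
    b (suc k) ∎

  module A = Increasing a a-step
  module B = Increasing b b-step

  W₁-above : ∀ {y} → W₁ a b y → a 0 ≤ y
  W₁-above (k , ak≤y , _) = ≤-trans (A.mono z≤n) ak≤y

  J-disjoint : ∀ {k y} → c k ≤ y → y ≤ d k → ¬ W₁ a b y
  J-disjoint {k} {y} ck≤y y≤dk (j , aj≤y , y≤bj) with j ℕ.≤? k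
  ... | yes j≤k = <-irrefl refl (begin-strict
    y         ≤⟨ y≤bj ⟩
    b j       ≤⟨ B.mono j≤k ⟩
    b k       <⟨ b<c k ⟩
    c k       ≤⟨ ck≤y ⟩
    y         ∎)
  ... | no  j≰k = <-irrefl refl (begin-strict
    y         ≤⟨ y≤dk ⟩
    d k       <⟨ d<a k ⟩
    a (suc k) ≤⟨ A.mono (ℕ.≰⇒> j≰k) ⟩
    a j       ≤⟨ aj≤y ⟩
    y         ∎)

  index-bound : ∀ {k x} → a k ≤ x → k ℕ.≤ ∣ x - a 0 ∣
  index-bound {k} {x} ak≤x = ≤-abs (≤-by (x - a k + (a k - (a 0 + + k)))
                                          (δ≤ ak≤x ⊞ δ≤ (A.growth k))
                                          (regroup x (a 0) (a k) (+ k)))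
    where
    regroup : ∀ x a₀ aₖ K → x - a₀ ≡ x - aₖ + (aₖ - (a₀ + K)) + K
    regroup = solve-∀

  straddle-bound : ∀ {k u v} → u < a k → b k < v → k ℕ.≤ ∣ v - u ∣
  straddle-bound {k} {u} {v} u<ak bk<v = ≤-abs (≤-by (v - (+ 1 + b k) + (a k - (+ 1 + u)) + (b k - (a k + + k)) + + 2)
                                                     (δ< bk<v ⊞ δ< u<ak ⊞ δ≤ (I-long k) ⊞ δℕ 2)
                                                     (regroup u v (a k) (b k) (+ k)))
    where
    regroup : ∀ u v aₖ bₖ K → v - u ≡ v - (+ 1 + bₖ) + (aₖ - (+ 1 + u)) + (bₖ - (aₖ + K)) + + 2 + K
    regroup = solve-∀

  -- Membership in ⋃ I_k is decidable: only the indices up to x - min I_1 need checking.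
  W₁? : ∀ x → Dec (W₁ a b x)
  W₁? x = map′ (λ (i , x∈Iᵢ) → toℕ i , x∈Iᵢ) bounded-index
               (Fin.any? λ i → (a (toℕ i) ≤? x) ×-dec (x ≤? b (toℕ i)))
    where
    bounded-index : W₁ a b x → ∃ λ i → Interval (a (toℕ i)) (b (toℕ i)) x
    bounded-index (k , x∈Iₖ) = fromℕ< (s≤s (index-bound (proj₁ x∈Iₖ))) ,
      subst (λ j → Interval (a j) (b j) x) (sym (Fin.toℕ-fromℕ< _)) x∈Iₖ

-- If the new element never covers an earlier
-- witness (freshness), every complement element keeps its own witness, covered by no other
-- element: this is minimality.
module Greedy (W : Subset) (W? : ∀ y → Dec (W y)) (pick : ℤ → ℤ)
              (hits : ∀ z → W (z - pick z))
              (fresh⁺ : ∀ k p → - + k ≤ p → p ≤ + k → ¬ W (p - pick (+ suc k)))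
              (fresh⁻ : ∀ k p → - + k ≤ p → p ≤ + suc k → ¬ W (p - pick -[1+ k ]))
              where

  -- An entry (c , p): a complement element c together with its witness p.
  Entry : Set
  Entry = ℤ × ℤ

  Covered : ℤ → List Entry → Set
  Covered z S = Any (λ e → W (z - proj₁ e)) S

  step : ℤ → List Entry → List Entry
  step z S with any? (λ e → W? (z - proj₁ e)) S
  ... | yes _ = S
  ... | no  _ = (pick z , z) ∷ S

  step-⊇ : ∀ z S {e} → e ∈ S → e ∈ step z S
  step-⊇ z S e∈S with any? (λ e → W? (z - proj₁ e)) S
  ... | yes _ = e∈S
  ... | no  _ = there e∈S

  step-covers : ∀ z S → Covered z (step z S)
  step-covers z S with any? (λ e → W? (z - proj₁ e)) S
  ... | yes covered = covered
  ... | no  _       = here (hits z)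

  step-witness : ∀ z S {e} → e ∈ step z S → e ∈ S ⊎ proj₂ e ≡ z
  step-witness z S e∈ with any? (λ e → W? (z - proj₁ e)) S
  step-witness z S e∈          | yes _ = inj₁ e∈
  step-witness z S (here refl) | no  _ = inj₂ refl
  step-witness z S (there e∈S) | no  _ = inj₁ e∈S

  covered-⊇ : ∀ {z S S′} → (∀ {e} → e ∈ S → e ∈ S′) → Covered z S → Covered z S′
  covered-⊇ S⊆S′ covered = let (e , e∈S , w) = find covered in lose (S⊆S′ e∈S) w

  Private : List Entry → Set
  Private S = ∀ {e e′} → e ∈ S → e′ ∈ S → W (proj₂ e - proj₁ e′) → proj₁ e′ ≡ proj₁ e

  step-private : ∀ z S → Private S → (∀ {e} → e ∈ S → ¬ W (proj₂ e - pick z)) → Private (step z S)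
  step-private z S priv fresh with any? (λ e → W? (z - proj₁ e)) S
  ... | yes _         = priv
  ... | no  uncovered = λ
    { (here refl) (here refl)   _ → refl
    ; (here refl) (there e′∈S) w → ⊥-elim (uncovered (lose e′∈S w))
    ; (there e∈S) (here refl)   w → ⊥-elim (fresh e∈S w)
    ; (there e∈S) (there e′∈S) w → priv e∈S e′∈S w }

  WitnessesIn : ℤ → ℤ → List Entry → Set
  WitnessesIn lo hi S = ∀ {e} → e ∈ S → lo ≤ proj₂ e × proj₂ e ≤ hi

  widen : ∀ {lo hi lo′ hi′ S} → lo′ ≤ lo → hi ≤ hi′ → WitnessesIn lo hi S → WitnessesIn lo′ hi′ S
  widen lo′≤lo hi≤hi′ inS e∈ = let (lo≤p , p≤hi) = inS e∈ in ≤-trans lo′≤lo lo≤p , ≤-trans p≤hi hi≤hi′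

  step-in : ∀ z S {lo hi} → WitnessesIn lo hi S → lo ≤ z → z ≤ hi → WitnessesIn lo hi (step z S)
  step-in z S inS lo≤z z≤hi e∈ with step-witness z S e∈
  ... | inj₁ e∈S = inS e∈S
  ... | inj₂ refl = lo≤z , z≤hi

  stage : ℕ → List Entry
  stage zero    = step (+ 0) []
  stage (suc k) = step -[1+ k ] (step (+ suc k) (stage k))

  stage-invariant : ∀ k → Private (stage k) × WitnessesIn (- + k) (+ k) (stage k)
  stage-invariant zero = step-private (+ 0) [] (λ ()) (λ ()) , step-in (+ 0) [] (λ ()) ≤-refl ≤-refl
  stage-invariant (suc k) =
    step-private -[1+ k ] S⁺ private⁺ (λ e∈ → fresh⁻ k _ (proj₁ (in⁺ e∈)) (proj₂ (in⁺ e∈))) ,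
    step-in -[1+ k ] S⁺ (widen (neg-mono-≤ k≤1+k) ≤-refl in⁺) ≤-refl -≤+
    where
    S⁺ = step (+ suc k) (stage k)
    k≤1+k = +≤+ (ℕ.n≤1+n k)
    private⁺ : Private S⁺
    private⁺ = step-private (+ suc k) (stage k) (proj₁ (stage-invariant k))
      (λ e∈ → let (lo≤p , p≤hi) = proj₂ (stage-invariant k) e∈ in fresh⁺ k _ lo≤p p≤hi)
    in⁺ : WitnessesIn (- + k) (+ suc k) S⁺
    in⁺ = step-in (+ suc k) (stage k) (widen ≤-refl k≤1+k (proj₂ (stage-invariant k))) neg-≤-pos ≤-refl

  stage-⊆ : ∀ {j k} → j ℕ.≤ k → ∀ {e} → e ∈ stage j → e ∈ stage k
  stage-⊆ j≤k = stage-⊆′ (ℕ.≤⇒≤′ j≤k)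
    where
    stage-⊆′ : ∀ {j k} → j ℕ.≤′ k → ∀ {e} → e ∈ stage j → e ∈ stage k
    stage-⊆′ ℕ.≤′-refl e∈ = e∈
    stage-⊆′ {k = suc k} (ℕ.≤′-step j≤′k) e∈ = step-⊇ _ _ (step-⊇ _ _ (stage-⊆′ j≤′k e∈))

  eventually-covered : ∀ z → ∃ λ k → Covered z (stage k)
  eventually-covered (+ zero)  = 0 , step-covers (+ 0) []
  eventually-covered (+ suc k) = suc k , covered-⊇ {+ suc k} (step-⊇ -[1+ k ] (step (+ suc k) (stage k))) (step-covers (+ suc k) (stage k))
  eventually-covered -[1+ k ]  = suc k , step-covers -[1+ k ] (step (+ suc k) (stage k))

  Complement : Subset
  Complement c = ∃ λ k → ∃ λ p → (c , p) ∈ stage k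

  covered⇒sum : ∀ {z k} → Covered z (stage k) → (W ⊕ Complement) z
  covered⇒sum {z} {k} covered =
    let ((c , p) , e∈ , w) = find covered in z - c , c , w , (k , p , e∈) , split-off z c

  is-complement : IsComplement W Complement
  is-complement = nonempty , λ z → covered⇒sum {z} {proj₁ (eventually-covered z)} (proj₂ (eventually-covered z))
    where
    nonempty : Nonempty Complement
    nonempty = let (_ , c , _ , Cc , _) = covered⇒sum {+ 0} {0} (proj₂ (eventually-covered (+ 0))) in c , Cc

  -- Removing c₀ uncovers its witness p: any other cover c′ of p would, at a common stage,
  -- violate privacy.
  is-minimal : ∀ c₀ → Complement c₀ → ¬ IsComplement W (remove Complement c₀)
  is-minimal c₀ (k , p , e∈) (_ , covers) =
    let (w , c′ , Ww , ((k′ , p′ , e′∈) , c′≢c₀) , p≡w+c′) = covers p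
        N = k ℕ.⊔ k′
    in c′≢c₀ (proj₁ (stage-invariant N) (stage-⊆ (ℕ.m≤m⊔n k k′) e∈) (stage-⊆ (ℕ.m≤n⊔m k k′) e′∈)
                    (subst W (difference p≡w+c′) Ww))

  minimal-complement : ∃ λ C → IsMinimalComplement W C
  minimal-complement = Complement , is-complement , is-minimal

Escapes : Subset → ℤ → ℤ → Subset
Escapes W floor t y = W y × y < floor × ¬ W (y + t)

record Layered (a b : ℕ → ℤ) (W : Subset) : Set where
  field
    intervals⊆ : ∀ {y} → W₁ a b y → W y
    split      : ∀ {y} → W y → y < a 0 ⊎ W₁ a b y
    W?         : ∀ y → Dec (W y)

-- Let [lo, hi] be a gap with at least 2K + 2 points, followed by hi + 1.  For z = K + 1
-- and the complement element z - (hi + 1), every p ∈ [-K, K] has p - (z - (hi + 1)) in the gap.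
into-gap-below : ∀ {p K lo hi} → - K ≤ p → p ≤ K → lo + (+ 1 + (K + K)) ≤ hi →
  lo ≤ p - (+ 1 + K - (hi + + 1)) × p - (+ 1 + K - (hi + + 1)) ≤ hi
into-gap-below {p} {K} {lo} {hi} -K≤p p≤K long =
  ≤-by (p - - K + (hi - (lo + (+ 1 + (K + K)))) + + 1) (δ≤ -K≤p ⊞ δ≤ long ⊞ δℕ 1) (regroup₁ p K lo hi) ,
  ≤-by (K - p) (δ≤ p≤K) (regroup₂ p K hi)
  where
  regroup₁ : ∀ p K lo hi → p - (+ 1 + K - (hi + + 1)) ≡ p - - K + (hi - (lo + (+ 1 + (K + K)))) + + 1 + lo
  regroup₁ = solve-∀
  regroup₂ : ∀ p K hi → hi ≡ K - p + (p - (+ 1 + K - (hi + + 1)))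
  regroup₂ = solve-∀

-- Likewise, if the gap [lo, hi] is preceded by b, then for z = -(K + 1) and the element
-- z - b, every p ∈ [-K, K + 1] has p - (z - b) in the gap.
into-gap-above : ∀ {p K lo hi b} → lo ≡ b + + 1 → - K ≤ p → p ≤ + 1 + K → lo + (+ 1 + (K + K)) ≤ hi →
  lo ≤ p - (- (+ 1 + K) - b) × p - (- (+ 1 + K) - b) ≤ hi
into-gap-above {p} {K} {lo} {hi} {b} refl -K≤p p≤1+K long =
  ≤-by (p - - K) (δ≤ -K≤p) (regroup₁ p K b) ,
  ≤-by (hi - (b + + 1 + (+ 1 + (K + K))) + (+ 1 + K - p)) (δ≤ long ⊞ δ≤ p≤1+K) (regroup₂ p K b hi)
  where
  regroup₁ : ∀ p K b → p - (- (+ 1 + K) - b) ≡ p - - K + (b + + 1)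
  regroup₁ = solve-∀
  regroup₂ : ∀ p K b hi → hi ≡ hi - (b + + 1 + (+ 1 + (K + K))) + (+ 1 + K - p) + (p - (- (+ 1 + K) - b))
  regroup₂ = solve-∀

module OnLayered {a b c d : ℕ → ℤ} (ID : IntervalData a b c d) {W : Subset} (layered : Layered a b W) where
  open IntervalData ID
  open Intervals ID
  open Layered layered
  open ≤-Reasoning

  gap : ∀ {k y} → c k ≤ y → y ≤ d k → ¬ W y
  gap {k} {y} ck≤y y≤dk Wy with split Wy
  ... | inj₂ y∈W₁ = J-disjoint ck≤y y≤dk y∈W₁
  ... | inj₁ y<a₀ = <-irrefl refl (begin-strict
    y   <⟨ y<a₀ ⟩
    a 0 ≤⟨ A.mono z≤n ⟩
    a k ≤⟨ I-nonempty k ⟩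
    b k <⟨ b<c k ⟩
    c k ≤⟨ ck≤y ⟩
    y   ∎)

  -- The greedy choice: z is covered by an endpoint of the interval next to the gap
  -- J_{2k+1} (k = |z| - 1), far enough that all earlier witnesses are sent into that gap.
  anchor : ℤ → ℤ
  anchor (+ zero)  = b 0
  anchor (+ suc k) = a (suc (suc (k ℕ.+ k)))
  anchor -[1+ k ]  = b (suc (k ℕ.+ k))

  pick : ℤ → ℤ
  pick z = z - anchor z

  hits : ∀ z → W (z - pick z)
  hits z = subst W (cancel z (anchor z)) (intervals⊆ (anchor∈W₁ z))
    where
    cancel : ∀ z y → y ≡ z - (z - y)
    cancel = solve-∀
    anchor∈W₁ : ∀ z → W₁ a b (anchor z)
    anchor∈W₁ (+ zero)  = 0 , I-nonempty 0 , ≤-refl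
    anchor∈W₁ (+ suc k) = _ , ≤-refl , I-nonempty _
    anchor∈W₁ -[1+ k ]  = _ , I-nonempty _ , ≤-refl

  fresh⁺ : ∀ k p → - + k ≤ p → p ≤ + k → ¬ W (p - pick (+ suc k))
  fresh⁺ k p -k≤p p≤k = subst (λ e → ¬ W (p - (+ suc k - e))) (sym (I-after-J M))
    (λ Wy → let (lo , hi) = into-gap-below -k≤p p≤k (J-long M) in gap lo hi Wy)
    where
    M = suc (k ℕ.+ k)

  fresh⁻ : ∀ k p → - + k ≤ p → p ≤ + suc k → ¬ W (p - pick -[1+ k ])
  fresh⁻ k p -k≤p p≤1+k Wy =
    let (lo , hi) = into-gap-above {b = b M} (J-after-I M) -k≤p p≤1+k (J-long M) in gap lo hi Wy
    where
    M = suc (k ℕ.+ k)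

  minimal-complement : ∃ λ C → IsMinimalComplement W C
  minimal-complement = Greedy.minimal-complement W W? pick hits fresh⁺ fresh⁻

  uncovered-by : ∀ {D x c} → ¬ (W ⊕ D) x → D c → ¬ W (x - c)
  uncovered-by {x = x} {c} uncovered Dc W[x-c] = uncovered (x - c , c , W[x-c] , Dc , split-off x c)

  -- An asymptotic complement C is infinite: were C ⊆ [-R, R], the points c k + R with k ≥ 2R
  -- would be uncovered (x - C ⊆ J_k), and they are unbounded.
  asymptotic-infinite : ∀ {C} → IsAsymptoticComplement W C → ¬ FiniteSet C
  asymptotic-infinite {C} (_ , L , L-lists) (M , M-lists) = <⇒≱ B<x (≤bound (L-lists x x-uncovered))
    where
    R = bound M
    B = bound L
    A = ∣ a 0 ∣
    k = R ℕ.+ R ℕ.+ B ℕ.+ A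
    x = c k + + R
    B<x : + B < x
    B<x = suc[i]≤j⇒i<j (≤-by (c k - (+ 1 + b k) + (b k - a k) + (a k - (a 0 + + k)) + (a 0 - - + A) + + R + + R + + R)
               (δ< (b<c k) ⊞ δ≤ (I-nonempty k) ⊞ δ≤ (A.growth k) ⊞ δ≤ (-+∣i∣≤i (a 0)) ⊞ δℕ R ⊞ δℕ R ⊞ δℕ R)
               (regroup (a 0) (a k) (b k) (c k) (+ R) (+ B) (+ A)))
      where
      regroup : ∀ a₀ aₖ bₖ cₖ R B A → cₖ + R ≡
        cₖ - (+ 1 + bₖ) + (bₖ - aₖ) + (aₖ - (a₀ + (R + R + B + A))) + (a₀ - - A) + R + R + R + (+ 1 + B)
      regroup = solve-∀
    x-uncovered : ¬ (W ⊕ C) x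
    x-uncovered (w , m , Ww , Cm , x≡w+m) = gap ck≤x-m x-m≤dk (subst W (difference x≡w+m) Ww)
      where
      m∈M = M-lists m Cm
      ck≤x-m : c k ≤ x - m
      ck≤x-m = ≤-by (+ R - m) (δ≤ (≤bound m∈M)) (regroup (c k) m (+ R))
        where
        regroup : ∀ cₖ m R → cₖ + R - m ≡ R - m + cₖ
        regroup = solve-∀
      x-m≤dk : x - m ≤ d k
      x-m≤dk = ≤-by (d k - (c k + + k) + (m - - + R) + + B + + A)
                    (δ≤ (J-long k) ⊞ δ≤ (-bound≤ m∈M) ⊞ δℕ B ⊞ δℕ A)
                    (regroup (c k) (d k) m (+ R) (+ B) (+ A))
        where
        regroup : ∀ cₖ dₖ m R B A → dₖ ≡ dₖ - (cₖ + (R + R + B + A)) + (m - - R) + B + A + (cₖ + R - m)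
        regroup = solve-∀

  escape-part : ∀ {D x w mid c′} → ¬ (W ⊕ D) x → D c′ → x ≡ w + mid → W w → w < a 0 →
                Escapes W (a 0) (mid - c′) w
  escape-part {w = w} {mid} {c′} uncovered Dc′ refl Ww w<a₀ =
    Ww , w<a₀ , subst (¬_ ∘ W) (regroup w mid c′) (uncovered-by uncovered Dc′)
    where
    regroup : ∀ w mid c′ → w + mid - c′ ≡ w + (mid - c′)
    regroup = solve-∀

  -- A point x = w + mid with w ∈ I_k, left uncovered by lo < mid < hi, forces I_k to fit
  -- strictly between x - hi and x - lo, so k ≤ hi - lo.
  interval-part : ∀ {D x w lo mid hi k} → ¬ (W ⊕ D) x → D lo → D hi → lo < mid → mid < hi →
                  x ≡ w + mid → a k ≤ w → w ≤ b k → k ℕ.≤ ∣ hi - lo ∣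
  interval-part {D} {w = w} {lo} {mid} {hi} {k} uncovered Dlo Dhi lo<mid mid<hi refl aₖ≤w w≤bₖ =
    subst (λ δ → k ℕ.≤ ∣ δ ∣) (regroup₃ w mid lo hi) (straddle-bound u<aₖ bₖ<v)
    where
    u≤w : w + mid - hi ≤ w
    u≤w = ≤-by (hi - (+ 1 + mid) + + 1) (δ< mid<hi ⊞ δℕ 1) (regroup₁ w mid hi)
      where
      regroup₁ : ∀ w mid hi → w ≡ hi - (+ 1 + mid) + + 1 + (w + mid - hi)
      regroup₁ = solve-∀
    w≤v : w ≤ w + mid - lo
    w≤v = ≤-by (mid - (+ 1 + lo) + + 1) (δ< lo<mid ⊞ δℕ 1) (regroup₂ w mid lo)
      where
      regroup₂ : ∀ w mid lo → w + mid - lo ≡ mid - (+ 1 + lo) + + 1 + w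
      regroup₂ = solve-∀
    u<aₖ : w + mid - hi < a k
    u<aₖ = ≰⇒> λ aₖ≤u → uncovered-by uncovered Dhi (intervals⊆ (k , aₖ≤u , ≤-trans u≤w w≤bₖ))
    bₖ<v : b k < w + mid - lo
    bₖ<v = ≰⇒> λ v≤bₖ → uncovered-by uncovered Dlo (intervals⊆ (k , ≤-trans aₖ≤w w≤v , v≤bₖ))
    regroup₃ : ∀ w mid lo hi → w + mid - lo - (w + mid - hi) ≡ hi - lo
    regroup₃ = solve-∀

  removable : ∀ {C lo mid hi c′} → IsAsymptoticComplement W C → C lo → C hi → lo < mid → mid < hi →
              C c′ → c′ ≢ mid → FiniteSet (Escapes W (a 0) (mid - c′)) →
              IsAsymptoticComplement W (remove C mid)
  removable {C} {lo} {mid} {hi} {c′} (_ , L , L-lists) Clo Chi lo<mid mid<hi Cc′ c′≢mid (E , E-lists) =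
    (hi , Chi , hi≢mid) , L ++ Recovered , listed
    where
    hi≢mid = ≢-sym (<⇒≢ mid<hi)
    N = ∣ hi - lo ∣
    translate : ℤ → ℤ
    translate y = y + mid
    Recovered = map translate E ++ window (a 0 + mid) (b N + mid)
    recovered : ∀ {x} → ¬ (W ⊕ remove C mid) x → (W ⊕ C) x → x ∈ Recovered
    recovered {x} uncovered (w , c″ , Ww , Cc″ , x≡w+c″) with c″ ≟ mid
    ... | no  c″≢mid = ⊥-elim (uncovered (w , c″ , Ww , (Cc″ , c″≢mid) , x≡w+c″))
    ... | yes c″≡mid = via-mid (trans x≡w+c″ (cong (λ c → w + c) c″≡mid)) (split Ww)
      where
      via-mid : x ≡ w + mid → w < a 0 ⊎ W₁ a b w → x ∈ Recovered
      via-mid x≡w+mid (inj₁ w<a₀) = ∈-++⁺ˡ (subst (_∈ map translate E) (sym x≡w+mid)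
        (∈-map⁺ translate (E-lists w (escape-part uncovered (Cc′ , c′≢mid) x≡w+mid Ww w<a₀))))
      via-mid x≡w+mid (inj₂ (k , aₖ≤w , w≤bₖ)) = ∈-++⁺ʳ (map translate E) (∈-window lower upper)
        where
        k≤N = interval-part uncovered (Clo , <⇒≢ lo<mid) (Chi , hi≢mid) lo<mid mid<hi x≡w+mid aₖ≤w w≤bₖ
        lower : a 0 + mid ≤ x
        lower = subst (a 0 + mid ≤_) (sym x≡w+mid) (+-monoˡ-≤ mid (≤-trans (A.mono z≤n) aₖ≤w))
        upper : x ≤ b N + mid
        upper = subst (_≤ b N + mid) (sym x≡w+mid) (+-monoˡ-≤ mid (≤-trans w≤bₖ (B.mono k≤N)))
    listed : ∀ x → ¬ (W ⊕ remove C mid) x → x ∈ L ++ Recovered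
    listed x uncovered = decidable-stable (x ∈? (L ++ Recovered)) λ x∉ →
      x∉ (∈-++⁺ˡ (L-lists x λ covered → x∉ (∈-++⁺ʳ L (recovered uncovered covered))))

  -- If W's escapes are finite under all shifts by multiples of n, no asymptotic complement
  -- is minimal: an infinite C contains p < q with n ∣ q - p and a third element w outside
  -- [p, q]; then p (if w < p) or q (if q < w) is redundant.
  no-minimal-asymptotic : ∀ n → n ≢ + 0 → (∀ t → n ∣ t → FiniteSet (Escapes W (a 0) t)) →
                          ¬ (∃ λ C → IsMinimalAsymptoticComplement W C)
  no-minimal-asymptotic n n≢0 escapes-finite (C , asymptotic , minimal) =
    congruent-pair n n≢0 infinite λ (p , q , Cp , Cq , p<q , n∣q-p) →
    outside infinite (window p q) λ (w , Cw , w∉) →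
    [ (λ w<p → minimal p Cp (removable asymptotic Cw Cq w<p p<q Cq (≢-sym (<⇒≢ p<q))
                                        (escapes-finite (p - q) (flip-∣ {n} {q} {p} n∣q-p))))
    , (λ q<w → minimal q Cq (removable asymptotic Cp Cw p<q q<w Cp (<⇒≢ p<q)
                                        (escapes-finite (q - p) n∣q-p)))
    ] (∉-window w∉)
    where
    infinite = asymptotic-infinite asymptotic

  good : ∀ n → n ≢ + 0 → (∀ t → n ∣ t → FiniteSet (Escapes W (a 0) t)) → GoodSet W
  good n n≢0 escapes-finite = minimal-complement , no-minimal-asymptotic n n≢0 escapes-finite

-- The four sets of the theorem are layered, and their escapes are finite: a point below
-- min I_1 can only leave the set by crossing min I_1 (or by landing in F, for W₃).
module FourSets {a b c d : ℕ → ℤ} (ID : IntervalData a b c d) where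
  open Intervals ID

  W₁-not-below : ∀ {y} → W₁ a b y → ¬ y < a 0
  W₁-not-below y∈W₁ y<a₀ = <⇒≱ y<a₀ (W₁-above y∈W₁)

  good₁ : GoodSet (W₁ a b)
  good₁ = OnLayered.good ID layered (+ 1) (λ ()) λ t _ → [] , λ y (y∈W₁ , y<a₀ , _) → ⊥-elim (W₁-not-below y∈W₁ y<a₀)
    where
    layered : Layered a b (W₁ a b)
    layered = record { intervals⊆ = λ y∈W₁ → y∈W₁ ; split = inj₂ ; W? = W₁? }

  good₂ : GoodSet (W₂ a b)
  good₂ = OnLayered.good ID layered (+ 1) (λ ()) λ t _ → window (a 0 - t) (a 0) ,
    λ y (_ , y<a₀ , y+t∉W₂) → ∈-crossing-window y<a₀ (≮⇒≥ λ y+t<a₀ → y+t∉W₂ (inj₁ y+t<a₀))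
    where
    layered : Layered a b (W₂ a b)
    layered = record { intervals⊆ = inj₂ ; split = λ y∈W₂ → y∈W₂ ; W? = λ y → (y <? a 0) ⊎-dec W₁? y }

  good₃ : ∀ F → GoodSet (W₃ a b F)
  good₃ F = OnLayered.good ID layered (+ 1) (λ ()) λ t _ → window (a 0 - t) (a 0) ++ map (λ f → f - t) F ,
    λ y (_ , y<a₀ , y+t∉W₃) → escape y t y<a₀ y+t∉W₃
    where
    layered : Layered a b (W₃ a b F)
    layered = record
      { intervals⊆ = inj₂
      ; split = λ { (inj₁ (y<a₀ , _)) → inj₁ y<a₀ ; (inj₂ y∈W₁) → inj₂ y∈W₁ }
      ; W? = λ y → ((y <? a 0) ×-dec ¬? (y ∈? F)) ⊎-dec W₁? y }
    cancel : ∀ y t → y + t - t ≡ y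
    cancel = solve-∀
    escape : ∀ y t → y < a 0 → ¬ W₃ a b F (y + t) → y ∈ window (a 0 - t) (a 0) ++ map (λ f → f - t) F
    escape y t y<a₀ y+t∉W₃ with y + t <? a 0
    ... | no  y+t≮a₀ = ∈-++⁺ˡ (∈-crossing-window y<a₀ (≮⇒≥ y+t≮a₀))
    ... | yes y+t<a₀ = ∈-++⁺ʳ (window (a 0 - t) (a 0))
      (subst (_∈ map (λ f → f - t) F) (cancel y t) (∈-map⁺ (λ f → f - t) y+t∈F))
      where
      y+t∈F = decidable-stable (y + t ∈? F) λ y+t∉F → y+t∉W₃ (inj₁ (y+t<a₀ , y+t∉F))

  good₄ : ∀ r n → n ≢ + 0 → GoodSet (W₄ a b r n)
  good₄ r n n≢0 = OnLayered.good ID layered n n≢0 λ t n∣t → window (a 0 - t) (a 0) , λ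
    { y (inj₁ (_ , n∣y-r) , y<a₀ , y+t∉W₄) →
        ∈-crossing-window y<a₀ (≮⇒≥ λ y+t<a₀ → y+t∉W₄ (inj₁ (y+t<a₀ , shifted y t n∣y-r n∣t)))
    ; y (inj₂ y∈W₁ , y<a₀ , _) → ⊥-elim (W₁-not-below y∈W₁ y<a₀) }
    where
    layered : Layered a b (W₄ a b r n)
    layered = record
      { intervals⊆ = inj₂
      ; split = λ { (inj₁ (y<a₀ , _)) → inj₁ y<a₀ ; (inj₂ y∈W₁) → inj₂ y∈W₁ }
      ; W? = λ y → ((y <? a 0) ×-dec (∣ n ∣ ℕ.∣? ∣ y - r ∣)) ⊎-dec W₁? y }
    regroup : ∀ y t r → y - r + t ≡ y + t - r
    regroup = solve-∀
    shifted : ∀ y t → n Unsigned.∣ (y - r) → n ∣ t → n Unsigned.∣ (y + t - r)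
    shifted y t n∣y-r n∣t = ∣⇒∣ᵤ (subst (n ∣_) (regroup y t r) (∣m∣n⇒∣m+n (∣ᵤ⇒∣ {n} {y - r} n∣y-r) n∣t))

theoremC : (a b c d : ℕ → ℤ) → IntervalData a b c d →
    GoodSet (W₁ a b)
    × GoodSet (W₂ a b)
    × (∀ (F : List ℤ) → F ≢ [] → GoodSet (W₃ a b F))
    × (∀ (r n : ℤ) → n ≢ + 0 → GoodSet (W₄ a b r n))
theoremC a b c d ID = good₁ , good₂ , (λ F _ → good₃ F) , good₄
  where open FourSets ID
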